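{- Let $k,n$ be positive integers and let $[x,y]$ be an interval of the poset $B_{\mathbf{1}_{S_k}}(k,n)$. Then $[x,y]$ is a $\mathbf{1}_{S_k}$-matroid representable over $\mathbb{C}$.
   Context: $S_k$ acts on $[n]^k$ by $w(x)=(x_{w^{ -1}(1)},\dots,x_{w^{ -1}(k)})$ and on $V^{\otimes k}$, $V=\mathbb{C}^n$ with basis $e_1,\dots,e_n$, by $w(e_x)=e_{w(x)}$ where $e_x=e_{x_1}\otimes\cdots\otimes e_{x_k}$; $P\mapsto P^{(n)}$ is the induced map $\mathbb{C}[S_k]\to\mathrm{End}(V^{\otimes k})$, and $P_{\mathbf{1}_{S_k}}=\frac1{k!}\sum_{g\in S_k}g$. For $x\in[n]^k$, $\overline x$ is the lexicographic minimum of its $S_k$-orbit (its nondecreasing rearrangement). $B_{\mathbf{1}_{S_k}}(k,n)=\{\overline x:x\in[n]^k\}$, ordered by $x\preccurlyeq y$ iff $x\leqslant g(y)$ componentwise for some $g\in S_k$. The vectors $P^{(n)}_{\mathbf{1}_{S_k}}(e_x)$, $x\in B_{\mathbf{1}_{S_k}}(k,n)$, form a basis of $\mathrm{Im}(P^{(n)}_{\mathbf{1}_{S_k}})$; for $v=\sum a_xP^{(n)}_{\mathbf{1}_{S_k}}(e_x)\ne 0$, $\mathrm{supp}[v]=\{x:a_x\neq0\}$. A subset $X\subseteq B_{\mathbf{1}_{S_k}}(k,n)$ is a $\mathbf{1}_{S_k}$-matroid if for every $\sigma\in S_n$, with $\sigma^*(x)=(\sigma(x_1),\dots,\sigma(x_k))$,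 the subposet $\{\overline{\sigma^*(x)}:x\in X\}$ has a unique maximum. $X$ is representable over $\mathbb{C}$ if $X=\mathrm{supp}[P^{(n)}_{\mathbf{1}_{S_k}}(v_1\otimes\cdots\otimes v_k)]$ for some $v_1,\dots,v_k\in V\setminus\{0\}$ with $P^{(n)}_{\mathbf{1}_{S_k}}(v_1\otimes\cdots\otimes v_k)\neq0$. -}

module Defs where

open import Level using (Level; _⊔_) renaming (suc to lsuc)
open import Data.Nat using (ℕ; zero; suc)
open import Data.Fin using (Fin; zero; suc; _≤_)
import Data.Fin as Fin
open import Data.Fin.Properties using (_≤?_; _≟_)
open import Data.Fin.Permutation using (Permutation′; _⟨$⟩ˡ_)
open import Data.Vec using (Vec; []; _∷_; lookup; map)
open import Data.Vec.Properties using (≡-dec)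
open import Data.List using (List; []; _∷_; concatMap; allFin) renaming (map to lmap)
open import Data.Product using (Σ; ∃; _×_; _,_)
open import Relation.Nullary using (¬_; yes; no)
open import Relation.Binary.PropositionalEquality using (_≡_)
open import Algebra.Bundles using (CommutativeRing)
open import Function.Bundles using (_⇔_)

natCast : ∀ {c ℓ} (R : CommutativeRing c ℓ) → ℕ → CommutativeRing.Carrier R
natCast R zero    = CommutativeRing.0# R
natCast R (suc m) = CommutativeRing._+_ R (CommutativeRing.1# R) (natCast R m)

record CharZeroField (c ℓ : Level) : Set (lsuc (c ⊔ ℓ)) where
  field
    commRing : CommutativeRing c ℓ
  open CommutativeRing commRing public hiding (ring)
  field
    1≉0      : ¬ (1# ≈ 0#)
    inverse  : ∀ a → ¬ (a ≈ 0#) → ∃ λ b → a * b ≈ 1#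
    charZero : ∀ m → ¬ (natCast commRing (suc m) ≈ 0#)

insert : ∀ {n k} → Fin n → Vec (Fin n) k → Vec (Fin n) (suc k)
insert a [] = a ∷ []
insert a (b ∷ bs) with a ≤? b
... | yes _ = a ∷ b ∷ bs
... | no  _ = b ∷ insert a bs

sortV : ∀ {n k} → Vec (Fin n) k → Vec (Fin n) k
sortV []       = []
sortV (a ∷ as) = insert a (sortV as)

InB : ∀ {k n} → Vec (Fin n) k → Set
InB {k} {n} y = ∃ λ (x : Vec (Fin n) k) → sortV x ≡ y

-- x ≼ y  iff  x ≤ g(y) componentwise for some g ∈ S_k,
-- where g(y)_i = y_{g⁻¹(i)}
_≼_ : ∀ {k n} → Vec (Fin n) k → Vec (Fin n) k → Set
_≼_ {k} x y = ∃ λ (g : Permutation′ k) →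
  ∀ (i : Fin k) → lookup x i ≤ lookup y (g ⟨$⟩ˡ i)

InInterval : ∀ {k n} → Vec (Fin n) k → Vec (Fin n) k → Vec (Fin n) k → Set
InInterval x y z = InB z × (x ≼ z) × (z ≼ y)

act* : ∀ {k n} → Permutation′ n → Vec (Fin n) k → Vec (Fin n) k
act* σ x = map (Permutation′-to σ) x
  where
  open import Data.Fin.Permutation using (_⟨$⟩ʳ_)
  Permutation′-to : ∀ {n} → Permutation′ n → Fin n → Fin n
  Permutation′-to σ i = σ ⟨$⟩ʳ i

Image : ∀ {k n} → Permutation′ n → (Vec (Fin n) k → Set) → Vec (Fin n) k → Set
Image {k} {n} σ X w = ∃ λ (x : Vec (Fin n) k) → X x × (sortV (act* σ x) ≡ w)

-- the subposet S has a unique maximum (= a greatest element; it is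
-- automatically unique since ≼ is antisymmetric on B)
HasUniqueMax : ∀ {k n} → (Vec (Fin n) k → Set) → Set
HasUniqueMax {k} {n} S = ∃ λ (m : Vec (Fin n) k) → S m × (∀ w → S w → w ≼ m)

IsMatroid : ∀ {k n} → (Vec (Fin n) k → Set) → Set
IsMatroid {k} {n} X = ∀ (σ : Permutation′ n) → HasUniqueMax (Image σ X)

allVecs : ∀ k n → List (Vec (Fin n) k)
allVecs zero    n = [] ∷ []
allVecs (suc k) n = concatMap (λ i → lmap (i ∷_) (allVecs k n)) (allFin n)

module _ {c ℓ} (F : CharZeroField c ℓ) where
  open CharZeroField F using (Carrier; _≈_; _+_; _*_; 0#; 1#)

  sumL : List Carrier → Carrier
  sumL []       = 0#
  sumL (a ∷ as) = a + sumL as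

  tensorCoeff : ∀ {k n} → (Fin k → Fin n → Carrier) → Vec (Fin n) k → Carrier
  tensorCoeff v []       = 1#
  tensorCoeff v (a ∷ as) = v Fin.zero a * tensorCoeff (λ i → v (suc i)) as

  -- Since P(e_x) = P(e_{x̄}), P(v_1⊗⋯⊗v_k) = Σ_{y ∈ B} a_y P(e_y) with
  --   a_y = Σ_{x ∈ [n]^k, x̄ = y} ∏_i v_i(x_i).
  coeffP : ∀ {k n} → (Fin k → Fin n → Carrier) → Vec (Fin n) k → Carrier
  coeffP {k} {n} v y = sumL (lmap term (allVecs k n))
    where
    term : Vec (Fin n) k → Carrier
    term x with ≡-dec _≟_ (sortV x) y
    ... | yes _ = tensorCoeff v x
    ... | no  _ = 0#

  Representable : ∀ {k n} → (Vec (Fin n) k → Set) → Set (c ⊔ ℓ)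
  Representable {k} {n} X =
    ∃ λ (v : Fin k → Fin n → Carrier) →
      (∀ i → ∃ λ j → ¬ (v i j ≈ 0#)) ×
      (∃ λ y → InB y × ¬ (coeffP v y ≈ 0#)) ×
      (∀ y → InB y → ((¬ (coeffP v y ≈ 0#)) ⇔ X y)) ×
      (∀ y → X y → InB y)

{-# OPTIONS --safe #-}
module Submission where

-- For nondecreasing tuples, x ≼ y just means x ≤ y componentwise: if yᵢ < xᵢ, the
-- permutation would have to send the i+1 positions l ≤ i injectively to positions
-- below i. Hence [x,y] is the set of sorted tuples in the box ∏ᵢ [xᵢ,yᵢ], and also the
-- image of that box under sorting, since sorting is monotone. Given σ ∈ S_n, let M
-- maximise σ in each coordinate of the box; the sorted σ-image of any z ∈ [x,y] lies
-- componentwise below that of M, so it is the greatest element. For the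
-- representation take vᵢ the indicator of [xᵢ,yᵢ]: the coefficient of P(e_z) counts
-- the tuples of the box whose sorting is z, which is nonzero in characteristic zero
-- exactly when z ∈ [x,y].

open import Defs
open import Level using (Level)
open import Data.Nat using (ℕ; suc; s≤s; s≤s⁻¹) renaming (_<_ to _<ℕ_)
import Data.Nat.Properties as ℕ
open import Data.Fin as Fin using (Fin; zero; suc; _≤_; _<_; toℕ)
open import Data.Fin.Properties
  using (_≟_; _≤?_; ≤-refl; ≤-trans; <-cmp; ≤-poset; ≤-totalOrder;
         toℕ<n; toℕ-injective; toℕ-inject≤; inject≤-injective; fromℕ<-injective; <⇒notInjective)
import Data.Fin.Permutation as Perm
open import Data.Fin.Permutation using (_⟨$⟩ʳ_; _⟨$⟩ˡ_; inverseˡ)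
open import Data.Vec using (Vec; []; _∷_; lookup; map)
open import Data.Vec.Properties using (≡-dec)
open import Data.Vec.Relation.Unary.All as All using (All; []; _∷_)
open import Data.Vec.Relation.Unary.All.Properties using (lookup⁺)
open import Data.Vec.Relation.Unary.AllPairs using (AllPairs; []; _∷_)
open import Data.Vec.Relation.Binary.Pointwise.Inductive as Pointwise
  using (Pointwise; []; _∷_)
open import Data.Vec.Relation.Binary.Pointwise.Extensional using (ext; extensional⇒inductive)
open import Data.List as List using ([]; _∷_; allFin; filter; length)
open import Data.List.Properties using (filter-none; filter-some)
open import Data.List.Relation.Unary.Any as Any using (here)
import Data.List.Relation.Unary.All as ListAll
open import Data.List.Relation.Unary.All.Properties using (all-filter; ¬Any⇒All¬)
open import Data.List.Membership.Propositional using (_∈_)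
open import Data.List.Membership.Propositional.Properties
  using (∈-filter⁺; ∈-allFin; ∈-map⁺; ∈-concatMap⁺)
import Data.List.Extrema as Extrema
open import Data.Product using (_×_; _,_; ∃; proj₁)
open import Data.Sum using (inj₁; inj₂)
open import Data.Empty using (⊥-elim)
open import Function.Base using (_∘_)
open import Function.Bundles using (Injection; Equivalence; _⇔_; mk⇔)
open import Function.Definitions using (Injective)
open import Function.Properties.Inverse using (↔⇒↣)
open import Relation.Unary using (Decidable)
open import Relation.Nullary using (¬_; Dec; yes; no; contradiction)
open import Relation.Nullary.Decidable using (_×-dec_)
open import Relation.Binary.Definitions using (tri<; tri≈; tri>)
open import Relation.Binary.PropositionalEquality
  using (_≡_; refl; sym; trans; cong; subst; module ≡-Reasoning)

private variable
  k m n : ℕ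
  a b : Fin n
  s t : Vec (Fin n) k

Sorted : Vec (Fin n) k → Set
Sorted = AllPairs _≤_

_≤ᵛ_ : Vec (Fin n) k → Vec (Fin n) k → Set
_≤ᵛ_ = Pointwise _≤_

≰⇒≥ : ¬ a ≤ b → b ≤ a
≰⇒≥ a≰b = ℕ.<⇒≤ (ℕ.≰⇒> a≰b)

insert-≤ : (s : Vec (Fin n) k) → a ≤ b → insert a (b ∷ s) ≡ a ∷ b ∷ s
insert-≤ {a = a} {b} s a≤b with a ≤? b
... | yes _   = refl
... | no a≰b = contradiction a≤b a≰b

insert-≰ : (s : Vec (Fin n) k) → ¬ a ≤ b → insert a (b ∷ s) ≡ b ∷ insert a s
insert-≰ {a = a} {b} s a≰b with a ≤? b
... | yes a≤b = contradiction a≤b a≰b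
... | no _    = refl

insert-head : All (a ≤_) s → insert a s ≡ a ∷ s
insert-head []          = refl
insert-head (a≤b ∷ _) = insert-≤ _ a≤b

All-insert : ∀ {P : Fin n → Set} (s : Vec (Fin n) k) → P a → All P s → All P (insert a s)
All-insert         []      pa []         = pa ∷ []
All-insert {a = a} (b ∷ s) pa (pb ∷ ps) with a ≤? b
... | yes _ = pa ∷ pb ∷ ps
... | no  _ = pb ∷ All-insert s pa ps

insert-sorted : ∀ a (s : Vec (Fin n) k) → Sorted s → Sorted (insert a s)
insert-sorted a []      []          = [] ∷ []
insert-sorted a (b ∷ s) (b≤s ∷ s↑) with a ≤? b
... | yes a≤b = (a≤b ∷ All.map (≤-trans a≤b) b≤s) ∷ b≤s ∷ s↑
... | no  a≰b = All-insert s (≰⇒≥ a≰b) b≤s ∷ insert-sorted a s s↑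

sortV-sorted : (v : Vec (Fin n) k) → Sorted (sortV v)
sortV-sorted []      = []
sortV-sorted (a ∷ v) = insert-sorted a (sortV v) (sortV-sorted v)

sortV-id : Sorted s → sortV s ≡ s
sortV-id []          = refl
sortV-id {s = a ∷ s} (a≤s ∷ s↑) = trans (cong (insert a) (sortV-id s↑)) (insert-head a≤s)

InB⇒Sorted : InB s → Sorted s
InB⇒Sorted (v , refl) = sortV-sorted v

insert-mono : Sorted s → Sorted t → a ≤ b → s ≤ᵛ t → insert a s ≤ᵛ insert b t
insert-mono []             []             a≤b []              = a≤b ∷ []
insert-mono {s = c ∷ s} {t = d ∷ t} {a = a} {b = b}
            (c≤s ∷ s↑) (d≤t ∷ t↑) a≤b (c≤d ∷ s≤t) with a ≤? c | b ≤? d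
... | yes a≤c | yes _   = a≤b ∷ c≤d ∷ s≤t
... | yes a≤c | no  b≰d = ≤-trans a≤c c≤d
  ∷ subst (_≤ᵛ insert b t) (insert-head c≤s)
          (insert-mono s↑ t↑ (≤-trans c≤d (≰⇒≥ b≰d)) s≤t)
... | no  a≰c | yes b≤d = ≤-trans (≰⇒≥ a≰c) a≤b
  ∷ subst (insert a s ≤ᵛ_) (insert-head d≤t)
          (insert-mono s↑ t↑ (≤-trans a≤b b≤d) s≤t)
... | no  _   | no  _   = c≤d ∷ insert-mono s↑ t↑ a≤b s≤t

sortV-mono : s ≤ᵛ t → sortV s ≤ᵛ sortV t
sortV-mono []                            = []
sortV-mono {s = _ ∷ s} {t = _ ∷ t} (a≤b ∷ s≤t) =
  insert-mono (sortV-sorted s) (sortV-sorted t) a≤b (sortV-mono s≤t)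

insert-comm-< : (s : Vec (Fin n) k) → a < b → insert a (insert b s) ≡ insert b (insert a s)
insert-comm-< {a = a} {b} [] a<b =
  trans (insert-≤ [] (ℕ.<⇒≤ a<b)) (sym (insert-≰ [] (ℕ.<⇒≱ a<b)))
insert-comm-< {a = a} {b} (c ∷ s) a<b
  with ℕ.≤-<-connex (toℕ b) (toℕ c) | ℕ.≤-<-connex (toℕ a) (toℕ c)
... | inj₁ b≤c | _ = begin
  insert a (insert b (c ∷ s))  ≡⟨ cong (insert a) (insert-≤ s b≤c) ⟩
  insert a (b ∷ c ∷ s)         ≡⟨ insert-≤ (c ∷ s) a≤b ⟩
  a ∷ b ∷ c ∷ s                ≡⟨ cong (a ∷_) (insert-≤ s b≤c) ⟨
  a ∷ insert b (c ∷ s)         ≡⟨ insert-≰ (c ∷ s) b≰a ⟨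
  insert b (a ∷ c ∷ s)         ≡⟨ cong (insert b) (insert-≤ s (≤-trans a≤b b≤c)) ⟨
  insert b (insert a (c ∷ s))  ∎
  where open ≡-Reasoning
        a≤b = ℕ.<⇒≤ a<b
        b≰a = ℕ.<⇒≱ a<b
... | inj₂ c<b | inj₁ a≤c = begin
  insert a (insert b (c ∷ s))  ≡⟨ cong (insert a) (insert-≰ s (ℕ.<⇒≱ c<b)) ⟩
  insert a (c ∷ insert b s)    ≡⟨ insert-≤ (insert b s) a≤c ⟩
  a ∷ c ∷ insert b s           ≡⟨ cong (a ∷_) (insert-≰ s (ℕ.<⇒≱ c<b)) ⟨
  a ∷ insert b (c ∷ s)         ≡⟨ insert-≰ (c ∷ s) (ℕ.<⇒≱ a<b) ⟨
  insert b (a ∷ c ∷ s)         ≡⟨ cong (insert b) (insert-≤ s a≤c) ⟨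
  insert b (insert a (c ∷ s))  ∎
  where open ≡-Reasoning
... | inj₂ c<b | inj₂ c<a = begin
  insert a (insert b (c ∷ s))  ≡⟨ cong (insert a) (insert-≰ s (ℕ.<⇒≱ c<b)) ⟩
  insert a (c ∷ insert b s)    ≡⟨ insert-≰ (insert b s) (ℕ.<⇒≱ c<a) ⟩
  c ∷ insert a (insert b s)    ≡⟨ cong (c ∷_) (insert-comm-< s a<b) ⟩
  c ∷ insert b (insert a s)    ≡⟨ insert-≰ (insert a s) (ℕ.<⇒≱ c<b) ⟨
  insert b (c ∷ insert a s)    ≡⟨ cong (insert b) (insert-≰ s (ℕ.<⇒≱ c<a)) ⟨
  insert b (insert a (c ∷ s))  ∎
  where open ≡-Reasoning

insert-comm : ∀ a b (s : Vec (Fin n) k) → insert a (insert b s) ≡ insert b (insert a s)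
insert-comm a b s with <-cmp a b
... | tri< a<b _ _ = insert-comm-< s a<b
... | tri≈ _ refl _ = refl
... | tri> _ _ b<a = sym (insert-comm-< s b<a)

sortV-map-insert : (f : Fin n → Fin m) (a : Fin n) (s : Vec (Fin n) k) →
                   sortV (map f (insert a s)) ≡ insert (f a) (sortV (map f s))
sortV-map-insert f a []      = refl
sortV-map-insert f a (b ∷ s) with a ≤? b
... | yes _ = refl
... | no  _ = trans (cong (insert (f b)) (sortV-map-insert f a s))
                    (insert-comm (f b) (f a) (sortV (map f s)))

sortV-map-sortV : (f : Fin n → Fin m) (v : Vec (Fin n) k) →
                  sortV (map f (sortV v)) ≡ sortV (map f v)
sortV-map-sortV f []      = refl
sortV-map-sortV f (a ∷ v) =
  trans (sortV-map-insert f a (sortV v)) (cong (insert (f a)) (sortV-map-sortV f v))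

sorted-lookup-mono : Sorted s → ∀ {i j} → i ≤ j → lookup s i ≤ lookup s j
sorted-lookup-mono (_   ∷ _)  {zero}  {zero}  _         = ≤-refl
sorted-lookup-mono (a≤s ∷ _)  {zero}  {suc j} _         = lookup⁺ a≤s j
sorted-lookup-mono (_   ∷ s↑) {suc i} {suc j} (s≤s i≤j) = sorted-lookup-mono s↑ i≤j

sorted-≼⇒≤ᵛ : Sorted s → Sorted t → s ≼ t → s ≤ᵛ t
sorted-≼⇒≤ᵛ {s = s} {t = t} s↑ t↑ (g , s≤t∘g) = extensional⇒inductive (ext sᵢ≤tᵢ)
  where
  sᵢ≤tᵢ : ∀ i → lookup s i ≤ lookup t i
  sᵢ≤tᵢ i with lookup s i ≤? lookup t i
  ... | yes sᵢ≤tᵢ = sᵢ≤tᵢ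
  ... | no  sᵢ≰tᵢ = ⊥-elim (<⇒notInjective (ℕ.n<1+n (toℕ i)) g↾-injective)
    where
    below : ∀ l → l ≤ i → g ⟨$⟩ʳ l < i
    below l l≤i = ℕ.≰⇒> λ i≤gl → sᵢ≰tᵢ (begin
      lookup s i                    ≤⟨ sorted-lookup-mono s↑ i≤gl ⟩
      lookup s (g ⟨$⟩ʳ l)            ≤⟨ s≤t∘g (g ⟨$⟩ʳ l) ⟩
      lookup t (g ⟨$⟩ˡ (g ⟨$⟩ʳ l))  ≡⟨ cong (lookup t) (inverseˡ g) ⟩
      lookup t l                    ≤⟨ sorted-lookup-mono t↑ l≤i ⟩
      lookup t i                    ∎)
      where open import Relation.Binary.Reasoning.PartialOrder (≤-poset _)

    ι : Fin (suc (toℕ i)) → Fin _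
    ι l = Fin.inject≤ l (toℕ<n i)

    ι≤i : ∀ l → ι l ≤ i
    ι≤i l = ℕ.≤-trans (ℕ.≤-reflexive (toℕ-inject≤ l (toℕ<n i))) (s≤s⁻¹ (toℕ<n l))

    g↾ : Fin (suc (toℕ i)) → Fin (toℕ i)
    g↾ l = Fin.fromℕ< (below (ι l) (ι≤i l))

    g↾-injective : Injective _≡_ _≡_ g↾
    g↾-injective = inject≤-injective _ _ _ _
                 ∘ Injection.injective (↔⇒↣ g)
                 ∘ toℕ-injective
                 ∘ fromℕ<-injective _ _ _ _

InBox : Vec (Fin n) k → Vec (Fin n) k → Vec (Fin n) k → Set
InBox x y w = x ≤ᵛ w × w ≤ᵛ y

≤ᵛ⇒≼ : s ≤ᵛ t → s ≼ t
≤ᵛ⇒≼ s≤t = Perm.id , Pointwise.lookup s≤t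

module _ {x y : Vec (Fin n) k} (x↑ : Sorted x) (y↑ : Sorted y) where

  interval⇒box : ∀ {z} → InInterval x y z → InBox x y z
  interval⇒box (z∈B , x≼z , z≼y) =
    sorted-≼⇒≤ᵛ x↑ z↑ x≼z , sorted-≼⇒≤ᵛ z↑ y↑ z≼y
    where z↑ = InB⇒Sorted z∈B

  sortV-box⇒interval : ∀ {w} → InBox x y w → InInterval x y (sortV w)
  sortV-box⇒interval {w} (x≤w , w≤y) =
    (w , refl) ,
    ≤ᵛ⇒≼ (subst (_≤ᵛ sortV w) (sortV-id x↑) (sortV-mono x≤w)) ,
    ≤ᵛ⇒≼ (subst (sortV w ≤ᵛ_) (sortV-id y↑) (sortV-mono w≤y))

argmax-on : (f : Fin n → Fin m) {P : Fin n → Set} → Decidable P → ∀ {j₀} → P j₀ →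
            ∃ λ j → P j × (∀ j′ → P j′ → f j′ ≤ f j)
argmax-on {n} f P? {j₀} Pj₀ =
  j , argmax-all f Pj₀ (all-filter P? (allFin n)) ,
  λ j′ Pj′ → ListAll.lookup (f[xs]≤f[argmax] j₀ (filter P? (allFin n)))
                            (∈-filter⁺ P? (∈-allFin j′) Pj′)
  where
  open Extrema (≤-totalOrder _)
  j = argmax f j₀ (filter P? (allFin n))

argmax-box : (f : Fin n → Fin m) {x y : Vec (Fin n) k} → x ≤ᵛ y →
  ∃ λ M → InBox x y M × (∀ w → InBox x y w → map f w ≤ᵛ map f M)
argmax-box f []            = [] , ([] , []) , λ { [] _ → [] }
argmax-box f (l≤u ∷ x≤y)
  with j , (l≤j , j≤u) , j-max ← argmax-on f (λ j → (_ ≤? j) ×-dec (j ≤? _))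
                                            (≤-refl , l≤u)
     | M , (x≤M , M≤y) , M-max ← argmax-box f x≤y
  = j ∷ M , (l≤j ∷ x≤M , j≤u ∷ M≤y) ,
    λ { (a ∷ w) (l≤a ∷ x≤w , a≤u ∷ w≤y) → j-max a (l≤a , a≤u) ∷ M-max w (x≤w , w≤y) }

interval-isMatroid : {x y : Vec (Fin n) k} → Sorted x → Sorted y → x ≤ᵛ y →
                     IsMatroid (InInterval x y)
interval-isMatroid {x = x} {y} x↑ y↑ x≤y σ
  with M , M∈box , M-max ← argmax-box (σ ⟨$⟩ʳ_) x≤y
  = sortV (act* σ (sortV M)) , (sortV M , sortV-box⇒interval x↑ y↑ M∈box , refl) , greatest
  where
  greatest : ∀ w → Image σ (InInterval x y) w → w ≼ sortV (act* σ (sortV M))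
  greatest _ (z , z∈X , refl) =
    ≤ᵛ⇒≼ (subst (sortV (act* σ z) ≤ᵛ_) (sym (sortV-map-sortV (σ ⟨$⟩ʳ_) M))
                (sortV-mono (M-max z (interval⇒box x↑ y↑ z∈X))))

allVecs-complete : (w : Vec (Fin n) k) → w ∈ allVecs k n
allVecs-complete         []      = here refl
allVecs-complete {n} {suc k} (a ∷ w) =
  ∈-concatMap⁺ (λ i → List.map (i ∷_) (allVecs k n))
    (Any.map (λ { refl → ∈-map⁺ (a ∷_) (allVecs-complete w) }) (∈-allFin a))

module _ {c ℓ} (F : CharZeroField c ℓ) where
  open CharZeroField F
    using (Carrier; _≈_; _+_; _*_; 0#; 1#; commRing; setoid; 1≉0; charZero;
           reflexive; +-cong; *-cong; +-identityˡ; *-identityˡ; zeroˡ)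
    renaming (refl to ≈-refl; sym to ≈-sym; trans to ≈-trans)
  open import Relation.Binary.Reasoning.Setoid setoid

  indicator : ∀ {p} {P : Set p} → Dec P → Carrier
  indicator (yes _) = 1#
  indicator (no  _) = 0#

  indicator-yes : ∀ {p} {P : Set p} (P? : Dec P) → P → indicator P? ≈ 1#
  indicator-yes (yes _) _  = ≈-refl
  indicator-yes (no ¬p) p  = contradiction p ¬p

  boxIndicator : Vec (Fin n) k → Vec (Fin n) k → Fin k → Fin n → Carrier
  boxIndicator x y i j = indicator ((lookup x i ≤? j) ×-dec (j ≤? lookup y i))

  boxIndicator-∈ : (x y : Vec (Fin n) k) (i : Fin k) {j : Fin n} →
                   lookup x i ≤ j → j ≤ lookup y i → boxIndicator x y i j ≈ 1#
  boxIndicator-∈ x y i {j} xᵢ≤j j≤yᵢ =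
    indicator-yes ((lookup x i ≤? j) ×-dec (j ≤? lookup y i)) (xᵢ≤j , j≤yᵢ)

  inBox? : (x y w : Vec (Fin n) k) → Dec (InBox x y w)
  inBox? x y w = Pointwise.decidable _≤?_ x w ×-dec Pointwise.decidable _≤?_ w y

  tensorCoeff-boxIndicator-∈ : {x y w : Vec (Fin n) k} → InBox x y w →
                               tensorCoeff F (boxIndicator x y) w ≈ 1#
  tensorCoeff-boxIndicator-∈ {x = []}    {[]}    {[]}    _ = ≈-refl
  tensorCoeff-boxIndicator-∈ {x = l ∷ x} {u ∷ y} {a ∷ w} (l≤a ∷ x≤w , a≤u ∷ w≤y) = begin
    boxIndicator (l ∷ x) (u ∷ y) zero a * tensorCoeff F (boxIndicator x y) w
      ≈⟨ *-cong (boxIndicator-∈ (l ∷ x) (u ∷ y) zero l≤a a≤u)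
                (tensorCoeff-boxIndicator-∈ (x≤w , w≤y)) ⟩
    1# * 1#
      ≈⟨ *-identityˡ 1# ⟩
    1# ∎

  tensorCoeff-boxIndicator-∉ : {x y w : Vec (Fin n) k} → ¬ InBox x y w →
                               tensorCoeff F (boxIndicator x y) w ≈ 0#
  tensorCoeff-boxIndicator-∉ {x = []}    {[]}    {[]}    ∉ = contradiction ([] , []) ∉
  tensorCoeff-boxIndicator-∉ {x = l ∷ x} {u ∷ y} {a ∷ w} ∉ with (l ≤? a) ×-dec (a ≤? u)
  ... | no  _           = zeroˡ _
  ... | yes (l≤a , a≤u) = ≈-trans (*-identityˡ _) (tensorCoeff-boxIndicator-∉
          λ { (x≤w , w≤y) → ∉ (l≤a ∷ x≤w , a≤u ∷ w≤y) })

  sumL-indicator : {A : Set} {G : A → Set} (G? : Decidable G) (t : A → Carrier) →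
                   (∀ a → t a ≈ indicator (G? a)) →
                   ∀ L → sumL F (List.map t L) ≈ natCast commRing (length (filter G? L))
  sumL-indicator G? t t≈𝟙 []      = ≈-refl
  sumL-indicator G? t t≈𝟙 (a ∷ L) with G? a | t≈𝟙 a
  ... | yes _ | tₐ≈1 = +-cong tₐ≈1 (sumL-indicator G? t t≈𝟙 L)
  ... | no  _ | tₐ≈0 = ≈-trans (+-cong tₐ≈0 (sumL-indicator G? t t≈𝟙 L)) (+-identityˡ _)

  natCast-≉0 : ∀ {m} → 0 <ℕ m → ¬ natCast commRing m ≈ 0#
  natCast-≉0 {suc m} _ = charZero m

  -- The summand of coeffP is local to its definition; unification recovers it.
  coeffP-summand : (v : Fin k → Fin n → Carrier) (z : Vec (Fin n) k) →
                   ∃ λ t → coeffP F v z ≡ sumL F (List.map t (allVecs k n))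
  coeffP-summand v z = _ , refl

  module _ (x y z : Vec (Fin n) k) where

    PreimageInBox : Vec (Fin n) k → Set
    PreimageInBox w = sortV w ≡ z × InBox x y w

    preimageInBox? : Decidable PreimageInBox
    preimageInBox? w = ≡-dec _≟_ (sortV w) z ×-dec inBox? x y w

    coeffP-summand-boxIndicator : ∀ w →
      proj₁ (coeffP-summand (boxIndicator x y) z) w ≈ indicator (preimageInBox? w)
    coeffP-summand-boxIndicator w with ≡-dec _≟_ (sortV w) z
    ... | no  _ = ≈-refl
    ... | yes _ with inBox? x y w
    ...   | yes w∈box = tensorCoeff-boxIndicator-∈ w∈box
    ...   | no  w∉box = tensorCoeff-boxIndicator-∉ w∉box

    coeffP-boxIndicator : coeffP F (boxIndicator x y) z ≈
                          natCast commRing (length (filter preimageInBox? (allVecs k n)))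
    coeffP-boxIndicator =
      sumL-indicator preimageInBox? _ coeffP-summand-boxIndicator (allVecs k n)

    coeffP-boxIndicator-≉0⇔ : (¬ coeffP F (boxIndicator x y) z ≈ 0#) ⇔ ∃ PreimageInBox
    coeffP-boxIndicator-≉0⇔ = mk⇔ to from
      where
      to : ¬ coeffP F (boxIndicator x y) z ≈ 0# → ∃ PreimageInBox
      to coeff≉0 with Any.any? preimageInBox? (allVecs k n)
      ... | yes some = Any.satisfied some
      ... | no  none = contradiction
        (≈-trans coeffP-boxIndicator
                 (reflexive (cong (natCast commRing ∘ length)
                                  (filter-none preimageInBox? (¬Any⇒All¬ _ none)))))
        coeff≉0
      from : ∃ PreimageInBox → ¬ coeffP F (boxIndicator x y) z ≈ 0#
      from (w , w-pre) coeff≈0 = natCast-≉0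
        (filter-some preimageInBox? (Any.map (λ { refl → w-pre }) (allVecs-complete w)))
        (≈-trans (≈-sym coeffP-boxIndicator) coeff≈0)

  interval-representable : {x y : Vec (Fin n) k} → InB x → Sorted y → x ≤ᵛ y →
                           Representable F (InInterval x y)
  interval-representable {x = x} {y} x∈B y↑ x≤y =
    boxIndicator x y , vᵢ≉0 , (x , x∈B , Equivalence.from (supp x x∈B) x∈X) , supp , λ _ → proj₁
    where
    x↑ = InB⇒Sorted x∈B
    X  = InInterval x y

    vᵢ≉0 : ∀ i → ∃ λ j → ¬ boxIndicator x y i j ≈ 0#
    vᵢ≉0 i = lookup x i , λ vᵢxᵢ≈0 →
      1≉0 (≈-trans (≈-sym (boxIndicator-∈ x y i ≤-refl (Pointwise.lookup x≤y i))) vᵢxᵢ≈0)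

    x∈X : X x
    x∈X = x∈B , ≤ᵛ⇒≼ {s = x} (Pointwise.refl ≤-refl) , ≤ᵛ⇒≼ x≤y

    supp : ∀ z → InB z → (¬ coeffP F (boxIndicator x y) z ≈ 0#) ⇔ X z
    supp z z∈B = mk⇔
      (λ coeff≉0 →
         let w , sortV-w≡z , w∈box = Equivalence.to (coeffP-boxIndicator-≉0⇔ x y z) coeff≉0
         in subst X sortV-w≡z (sortV-box⇒interval x↑ y↑ w∈box))
      (λ z∈X → Equivalence.from (coeffP-boxIndicator-≉0⇔ x y z)
                 (z , sortV-id (InB⇒Sorted z∈B) , interval⇒box x↑ y↑ z∈X))

proposition5p11 : ∀ {c ℓ : Level} (F : CharZeroField c ℓ) (k n : ℕ)
    (x y : Vec (Fin (suc n)) (suc k)) →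
    InB x → InB y → x ≼ y →
    IsMatroid (InInterval x y) × Representable F (InInterval x y)
proposition5p11 F k n x y x∈B y∈B x≼y =
  interval-isMatroid x↑ y↑ x≤y , interval-representable F x∈B y↑ x≤y
  where
  x↑ = InB⇒Sorted x∈B
  y↑ = InB⇒Sorted y∈B
  x≤y = sorted-≼⇒≤ᵛ x↑ y↑ x≼y
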